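{- Let $m,n\ge 0$ be integers. If each of the Domineering boards $2\times m$ and $2\times n$ is either a win for Vera or a second-player win, then the board $2\times(m+n+1)$ is either a win for Vera or a first-player win (i.e. Vera wins $2\times(m+n+1)$ when she moves first).
   Context: Domineering is a two-player game on a board of cells of the square lattice. Vera places vertical dominoes (covering two vertically adjacent empty cells), Hepzibah places horizontal dominoes (covering two horizontally adjacent empty cells); they alternate, and a player unable to move on her turn loses. A $2\times n$ board has $2$ rows and $n$ columns ($2\times 0$ is the empty board). A position is a win for Vera (resp. Hepzibah) if she wins regardless of who moves first, a first-player win if whoever moves first wins, and a second-player win if whoever moves second wins. -}

module Defs where

open import Data.Bool using (Bool; true; false)
open import Data.Product using (_×_; _,_)
open import Data.List using (List; []; _∷_; replicate)
open import Data.Nat using (ℕ)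

-- A position on a 2-row board: a list of columns, each column is
-- (top cell empty?, bottom cell empty?).  true = empty cell.
Column : Set
Column = Bool × Bool

Board : Set
Board = List Column

board2× : ℕ → Board
board2× n = replicate n (true , true)

data Player : Set where
  Vera Hepzibah : Player

other : Player → Player
other Vera     = Hepzibah
other Hepzibah = Vera

data VMove : Board → Board → Set where
  here  : ∀ {bs} → VMove ((true , true) ∷ bs) ((false , false) ∷ bs)
  there : ∀ {c bs bs'} → VMove bs bs' → VMove (c ∷ bs) (c ∷ bs')

data HMove : Board → Board → Set where
  top   : ∀ {b c bs} → HMove ((true , b) ∷ (true , c) ∷ bs) ((false , b) ∷ (false , c) ∷ bs)
  bot   : ∀ {a d bs} → HMove ((a , true) ∷ (d , true) ∷ bs) ((a , false) ∷ (d , false) ∷ bs)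
  there : ∀ {c bs bs'} → HMove bs bs' → HMove (c ∷ bs) (c ∷ bs')

Move : Player → Board → Board → Set
Move Vera     = VMove
Move Hepzibah = HMove

-- Normal play: MoverWins X p  = X, being to move in p, has a winning strategy;
--              MoverLoses X p = X, being to move in p, loses against best play
--              (in particular if X has no move).
mutual
  data MoverWins : Player → Board → Set where
    wins : ∀ {X p q} → Move X p q → MoverLoses (other X) q → MoverWins X p

  data MoverLoses : Player → Board → Set where
    loses : ∀ {X p} → (∀ {q} → Move X p q → MoverWins (other X) q) → MoverLoses X p

VeraWin : Board → Set
VeraWin p = MoverWins Vera p × MoverLoses Hepzibah p

SecondPlayerWin : Board → Set
SecondPlayerWin p = MoverLoses Vera p × MoverLoses Hepzibah p

FirstPlayerWin : Board → Set
FirstPlayerWin p = MoverWins Vera p × MoverWins Hepzibah p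

{-# OPTIONS --safe #-}
module Submission where

-- Vera's first move fills the middle column of 2 × (m + n + 1).  The filled
-- column blocks every horizontal domino across it, so what remains is the
-- disjunctive sum of 2 × m and 2 × n with Hepzibah to move.  She loses moving
-- first on each summand, hence on the sum: Vera answers every move in the
-- summand where it was made, using her winning reply there.  So Vera wins
-- moving first, and since finite games are determined the board is a win for
-- Vera or a first-player win according to whether Hepzibah loses or wins
-- moving first.

open import Defs
open import Data.Bool using (Bool; true; false)
open import Data.List using (List; []; _∷_; _++_; [_]; map)
open import Data.List.Membership.Propositional using (_∈_)
open import Data.List.Membership.Propositional.Properties using (∈-++⁺ˡ; ∈-++⁺ʳ; ∈-map⁺)
open import Data.List.Relation.Unary.All as All using (All; []; _∷_)
open import Data.List.Relation.Unary.Any as Any using (Any; here; there)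
open import Data.Nat using (ℕ; suc; _+_; _<_)
open import Data.Nat.Induction using (<-wellFounded)
open import Data.Nat.Properties using (n<1+n; <-trans; +-mono-<; +-monoˡ-<; +-monoʳ-<; +-comm)
open import Data.Product using (Σ; _,_; proj₂)
open import Data.Sum using (_⊎_; inj₁; inj₂; swap; [_,_]′)
open import Induction.WellFounded using (Acc; acc)
open import Relation.Binary.PropositionalEquality using (_≡_; refl; cong; subst; sym)

cell : Bool → ℕ
cell true  = 1
cell false = 0

columnCells : Column → ℕ
columnCells (a , b) = cell a + cell b

emptyCells : Board → ℕ
emptyCells []       = 0
emptyCells (c ∷ bs) = columnCells c + emptyCells bs

fill-top< : ∀ b → columnCells (false , b) < columnCells (true , b)
fill-top< b = n<1+n (cell b)

fill-bot< : ∀ a → columnCells (a , false) < columnCells (a , true)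
fill-bot< a = +-monoʳ-< (cell a) (n<1+n 0)

vmove-decreases : ∀ {p q} → VMove p q → emptyCells q < emptyCells p
vmove-decreases here          = <-trans (n<1+n _) (n<1+n _)
vmove-decreases (there {c} m) = +-monoʳ-< (columnCells c) (vmove-decreases m)

hmove-decreases : ∀ {p q} → HMove p q → emptyCells q < emptyCells p
hmove-decreases (top {b} {c} {bs}) = +-mono-< (fill-top< b) (+-monoˡ-< (emptyCells bs) (fill-top< c))
hmove-decreases (bot {a} {d} {bs}) = +-mono-< (fill-bot< a) (+-monoˡ-< (emptyCells bs) (fill-bot< d))
hmove-decreases (there {c} m)      = +-monoʳ-< (columnCells c) (hmove-decreases m)

move-decreases : ∀ X {p q} → Move X p q → emptyCells q < emptyCells p
move-decreases Vera     = vmove-decreases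
move-decreases Hepzibah = hmove-decreases

Successor : Player → Board → Set
Successor X p = Σ Board (Move X p)

vmoves : ∀ p → List (Successor Vera p)
vmoves []       = []
vmoves (c ∷ bs) = here-moves c ++ map there-move (vmoves bs)
  where
  here-moves : ∀ c → List (Successor Vera (c ∷ bs))
  here-moves (true , true) = [ _ , here ]
  here-moves _             = []

  there-move : Successor Vera bs → Successor Vera (c ∷ bs)
  there-move (q , m) = c ∷ q , there m

vmoves-complete : ∀ {p q} (m : VMove p q) → (q , m) ∈ vmoves p
vmoves-complete here                     = here refl
vmoves-complete (there {true , true} m)  = there (∈-map⁺ _ (vmoves-complete m))
vmoves-complete (there {true , false} m) = ∈-map⁺ _ (vmoves-complete m)
vmoves-complete (there {false , _} m)    = ∈-map⁺ _ (vmoves-complete m)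

top-moves : ∀ c d bs → List (Successor Hepzibah (c ∷ d ∷ bs))
top-moves (true , _) (true , _) bs = [ _ , top ]
top-moves _          _          bs = []

bot-moves : ∀ c d bs → List (Successor Hepzibah (c ∷ d ∷ bs))
bot-moves (_ , true) (_ , true) bs = [ _ , bot ]
bot-moves _          _          bs = []

hmoves : ∀ p → List (Successor Hepzibah p)
hmoves []           = []
hmoves (c ∷ [])     = []
hmoves (c ∷ d ∷ bs) = top-moves c d bs ++ bot-moves c d bs ++ map there-move (hmoves (d ∷ bs))
  where
  there-move : Successor Hepzibah (d ∷ bs) → Successor Hepzibah (c ∷ d ∷ bs)
  there-move (q , m) = c ∷ q , there m

hmoves-complete : ∀ {p q} (m : HMove p q) → (q , m) ∈ hmoves p
hmoves-complete top                    = here refl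
hmoves-complete (bot {a} {d} {bs})     = ∈-++⁺ʳ (top-moves (a , true) (d , true) bs) (here refl)
hmoves-complete (there {c} {d ∷ bs} m) =
  ∈-++⁺ʳ (top-moves c d bs) (∈-++⁺ʳ (bot-moves c d bs) (∈-map⁺ _ (hmoves-complete m)))

moves : ∀ X p → List (Successor X p)
moves Vera     = vmoves
moves Hepzibah = hmoves

moves-complete : ∀ X {p q} (m : Move X p q) → (q , m) ∈ moves X p
moves-complete Vera     = vmoves-complete
moves-complete Hepzibah = hmoves-complete

any⊎all : ∀ {A : Set} {P Q : A → Set} → (∀ x → P x ⊎ Q x) → ∀ xs → Any P xs ⊎ All Q xs
any⊎all p⊎q []       = inj₂ []
any⊎all p⊎q (x ∷ xs) with p⊎q x | any⊎all p⊎q xs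
... | inj₁ px | _        = inj₁ (here px)
... | inj₂ _  | inj₁ pxs = inj₁ (there pxs)
... | inj₂ qx | inj₂ qxs = inj₂ (qx ∷ qxs)

determined-acc : ∀ X p → Acc _<_ (emptyCells p) → MoverWins X p ⊎ MoverLoses X p
determined-acc X p (acc rec)
  with any⊎all (λ (q , m) → swap (determined-acc (other X) q (rec (move-decreases X m)))) (moves X p)
... | inj₁ winning-move = let ((q , m) , l) = Any.satisfied winning-move in inj₁ (wins m l)
... | inj₂ all-losing   = inj₂ (loses λ m → All.lookup all-losing (moves-complete X m))

determined : ∀ X p → MoverWins X p ⊎ MoverLoses X p
determined X p = determined-acc X p (<-wellFounded (emptyCells p))

infixr 5 _⊕_

_⊕_ : Board → Board → Board
a ⊕ b = a ++ (false , false) ∷ b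

data HMove-⊕ (a b : Board) : Board → Set where
  left  : ∀ {a'} → HMove a a' → HMove-⊕ a b (a' ⊕ b)
  right : ∀ {b'} → HMove b b' → HMove-⊕ a b (a ⊕ b')

hmove-⊕ : ∀ a b {q} → HMove (a ⊕ b) q → HMove-⊕ a b q
hmove-⊕ []          b (there m)         = right m
hmove-⊕ (c ∷ [])    b (there (there m)) = right m
hmove-⊕ (c ∷ d ∷ a) b top               = left top
hmove-⊕ (c ∷ d ∷ a) b bot               = left bot
hmove-⊕ (c ∷ d ∷ a) b (there m) with hmove-⊕ (d ∷ a) b m
... | left m'  = left (there m')
... | right m' = right m'

vmove-⊕ˡ : ∀ {a a'} b → VMove a a' → VMove (a ⊕ b) (a' ⊕ b)
vmove-⊕ˡ b here      = here
vmove-⊕ˡ b (there m) = there (vmove-⊕ˡ b m)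

vmove-⊕ʳ : ∀ a {b b'} → VMove b b' → VMove (a ⊕ b) (a ⊕ b')
vmove-⊕ʳ []      m = there m
vmove-⊕ʳ (c ∷ a) m = there (vmove-⊕ʳ a m)

mutual
  hepzibah-loses-⊕ : ∀ {a b} → MoverLoses Hepzibah a → MoverLoses Hepzibah b →
                     MoverLoses Hepzibah (a ⊕ b)
  hepzibah-loses-⊕ {a} {b} la lb = loses λ m → answer la lb (hmove-⊕ a b m)

  answer : ∀ {a b q} → MoverLoses Hepzibah a → MoverLoses Hepzibah b → HMove-⊕ a b q →
           MoverWins Vera q
  answer (loses ha) lb (left m)  = vera-wins-⊕ˡ (ha m) lb
  answer la (loses hb) (right m) = vera-wins-⊕ʳ la (hb m)

  vera-wins-⊕ˡ : ∀ {a b} → MoverWins Vera a → MoverLoses Hepzibah b → MoverWins Vera (a ⊕ b)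
  vera-wins-⊕ˡ {b = b} (wins v l) lb = wins (vmove-⊕ˡ b v) (hepzibah-loses-⊕ l lb)

  vera-wins-⊕ʳ : ∀ {a b} → MoverLoses Hepzibah a → MoverWins Vera b → MoverWins Vera (a ⊕ b)
  vera-wins-⊕ʳ {a} la (wins v l) = wins (vmove-⊕ʳ a v) (hepzibah-loses-⊕ la l)

fill-centre : ∀ a b → VMove (a ++ (true , true) ∷ b) (a ⊕ b)
fill-centre []      b = here
fill-centre (c ∷ a) b = there (fill-centre a b)

vera-wins-by-centre : ∀ a b → MoverLoses Hepzibah a → MoverLoses Hepzibah b →
                      MoverWins Vera (a ++ (true , true) ∷ b)
vera-wins-by-centre a b la lb = wins (fill-centre a b) (hepzibah-loses-⊕ la lb)

vera-first-outcome : ∀ {p} → MoverWins Vera p → VeraWin p ⊎ FirstPlayerWin p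
vera-first-outcome {p} vw with determined Hepzibah p
... | inj₁ hw = inj₂ (vw , hw)
... | inj₂ hl = inj₁ (vw , hl)

board2×-split : ∀ m n → board2× (m + n + 1) ≡ board2× m ++ (true , true) ∷ board2× n
board2×-split 0       n = cong board2× (+-comm n 1)
board2×-split (suc m) n = cong ((true , true) ∷_) (board2×-split m n)

mainTheorem9 : (m n : ℕ) → (VeraWin (board2× m) ⊎ SecondPlayerWin (board2× m)) → (VeraWin (board2× n) ⊎ SecondPlayerWin (board2× n)) → VeraWin (board2× (m + n + 1)) ⊎ FirstPlayerWin (board2× (m + n + 1))
mainTheorem9 m n hm hn =
  subst (λ p → VeraWin p ⊎ FirstPlayerWin p) (sym (board2×-split m n))
    (vera-first-outcome (vera-wins-by-centre (board2× m) (board2× n) (hepzibah-first hm) (hepzibah-first hn)))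
  where
  hepzibah-first : ∀ {p} → VeraWin p ⊎ SecondPlayerWin p → MoverLoses Hepzibah p
  hepzibah-first = [ proj₂ , proj₂ ]′
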